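{- Let $n\ge 1$, let $D_{2n}=\langle a,b \mid a^n,\ b^2,\ abab\rangle$ be the dihedral group of order $2n$, and let $S$ be a subset of $D_{2n}$ chosen uniformly at random among all $2^{2n}$ subsets. Let $k\in D_{2n}$ be a reflection, i.e. $k=a^ib$ for some integer $i$. Then \[ \mathbb{P}(k\notin S+S)\le (3/4)^n \quad\text{and}\quad \mathbb{P}(k\notin S-S)\le (3/4)^n . \]
   Context: The group operation of $D_{2n}$ is written as juxtaposition; following the paper's additive terminology, for $S\subseteq D_{2n}$ the sumset is $S+S=\{st : s,t\in S\}$ and the difference set is $S-S=\{st^{ -1} : s,t\in S\}$. -}

module Defs where

open import Data.Nat using (ℕ; zero; suc; _+_; _*_; _∸_; NonZero)
open import Data.Nat.DivMod using (_mod_)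
open import Data.Fin as Fin using (Fin; toℕ)
open import Data.Fin.Properties as FinP using ()
open import Data.Bool using (Bool; true; false; _∧_; _xor_; if_then_else_; not)
open import Data.Bool.Properties as BoolP using ()
open import Data.Product using (_×_; _,_; proj₁; proj₂)
open import Data.Bool.ListAction using (any)
open import Data.List using (List; []; _∷_; map; _++_; filterᵇ; length; concatMap)
open import Data.Vec as Vec using (Vec; lookup)
open import Relation.Nullary.Decidable using (⌊_⌋; _×-dec_)

-- The dihedral group D_{2n} = ⟨ a, b | aⁿ, b², abab ⟩, modelled concretely:
-- the pair (i , e) stands for the element aⁱ bᵉ  (i ∈ ℤ/n, e ∈ {0,1},
-- with false = 0, true = 1).
D : ℕ → Set
D n = Fin n × Bool

module _ (n : ℕ) .{{_ : NonZero n}} where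

  addₙ : Fin n → Fin n → Fin n
  addₙ i j = (toℕ i + toℕ j) mod n

  negₙ : Fin n → Fin n
  negₙ j = (n ∸ toℕ j) mod n

  -- group law: aⁱ bᵉ · aʲ bᶠ = a^(i + (-1)ᵉ j) b^(e+f)   (since b a = a⁻¹ b)
  mul : D n → D n → D n
  mul (i , e) (j , f) = addₙ i (if e then negₙ j else j) , (e xor f)

  inv : D n → D n
  inv (i , false) = negₙ i , false
  inv (i , true)  = i , true

  eqD : D n → D n → Bool
  eqD (i , e) (j , f) = ⌊ (i Fin.≟ j) ×-dec (e BoolP.≟ f) ⌋

  allD : List (D n)
  allD = map (λ i → i , false) (Data.List.allFin n) ++ map (λ i → i , true) (Data.List.allFin n)

  -- a subset of D_{2n}: indicator of the rotations and indicator of the reflections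
  Subset : Set
  Subset = Vec Bool n × Vec Bool n

  _∈ₛ_ : D n → Subset → Bool
  (i , false) ∈ₛ S = lookup (proj₁ S) i
  (i , true)  ∈ₛ S = lookup (proj₂ S) i

  inSumset : Subset → D n → Bool
  inSumset S k = any (λ s → any (λ t → (s ∈ₛ S) ∧ (t ∈ₛ S) ∧ eqD (mul s t) k) allD) allD

  inDiffset : Subset → D n → Bool
  inDiffset S k = any (λ s → any (λ t → (s ∈ₛ S) ∧ (t ∈ₛ S) ∧ eqD (mul s (inv t)) k) allD) allD

allVecs : (m : ℕ) → List (Vec Bool m)
allVecs zero = Vec.[] ∷ []
allVecs (suc m) = concatMap (λ v → (false Vec.∷ v) ∷ (true Vec.∷ v) ∷ []) (allVecs m)

allSubsets : (n : ℕ) .{{_ : NonZero n}} → List (Subset n)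
allSubsets n = concatMap (λ u → map (λ v → u , v) (allVecs n)) (allVecs n)

-- number of subsets S with k ∉ S+S  (resp. k ∉ S-S); the probability under the
-- uniform distribution on subsets is this count divided by 2^(2n)
countNotSum : (n : ℕ) .{{_ : NonZero n}} → D n → ℕ
countNotSum n k = length (filterᵇ (λ S → not (inSumset n S k)) (allSubsets n))

countNotDiff : (n : ℕ) .{{_ : NonZero n}} → D n → ℕ
countNotDiff n k = length (filterᵇ (λ S → not (inDiffset n S k)) (allSubsets n))

{-# OPTIONS --safe #-}
-- Write k = aⁱ b. For every m ∈ ℤ/n the rotation a^(i-m) and the reflection aᵐ b
-- satisfy a^(i-m) · aᵐ b = k, and since aᵐ b is an involution also
-- a^(i-m) · (aᵐ b)⁻¹ = k. These n pairs partition D_{2n}, so if k ∉ S+S or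
-- k ∉ S-S then S contains no pair completely: S is one of the 3ⁿ subsets that
-- meet every pair in at most one element, out of 4ⁿ = 2^(2n) subsets in total.
module Submission where

open import Defs
open import Data.Nat using (ℕ; _*_; _^_; _≤_; NonZero)
open import Data.Fin using (Fin)
open import Data.Bool using (true)
open import Data.Product using (_×_; _,_)

open import Data.Nat using (zero; suc; _+_; _∸_; _%_)
open import Data.Nat.Properties
  using (+-comm; +-assoc; +-identityʳ; *-identityˡ; <⇒≤; m+[n∸m]≡n;
         ≤-trans; ≤-reflexive; +-commutativeSemigroup; *-monoˡ-≤; ^-*-assoc; *-1-commutativeMonoid)
open import Data.Nat.DivMod
  using (_mod_; %-distribˡ-+; m%n%n≡m%n; m<n⇒m%n≡m; n%n≡0)
open import Data.Nat.ListAction using (sum)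
open import Data.Nat.Solver using (module +-*-Solver)
open import Algebra.Properties.CommutativeSemigroup +-commutativeSemigroup
  using () renaming (interchange to +-interchange)
open import Data.Fin as Fin using (toℕ)
open import Data.Fin.Properties using (toℕ-fromℕ<; toℕ-injective; toℕ<n)
open import Data.Fin.Permutation using (permutation)
open import Data.Bool using (Bool; false; not; _∧_; T; T?; if_then_else_)
open import Data.Bool.Properties using (T-∧)
open import Data.List using (List; []; _∷_; map; _++_; filterᵇ; length; concatMap; allFin)
open import Data.List.Properties using (filter-++; length-++; map-cong)
open import Data.List.Membership.Propositional using (_∈_; lose)
open import Data.List.Membership.Propositional.Properties using (∈-map⁺; ∈-++⁺ˡ; ∈-++⁺ʳ; ∈-allFin)
open import Data.List.Relation.Unary.Any.Properties using (any⁺)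
open import Data.List.Relation.Binary.Sublist.Propositional using (⊆-refl)
open import Data.List.Relation.Binary.Sublist.Propositional.Properties using (filter⁺; length-mono-≤)
open import Data.Vec using (Vec; lookup) renaming ([] to []ᵥ; _∷_ to _∷ᵥ_)
open import Data.Empty using (⊥)
open import Function using (_∘_; Equivalence)
open import Relation.Binary.PropositionalEquality using (_≡_; refl; sym; trans; cong; cong₂; subst; module ≡-Reasoning)
open import Relation.Nullary.Decidable using (fromWitness)
open import Algebra.Properties.CommutativeMonoid.Sum *-1-commutativeMonoid
  using (sum-permute) renaming (sum to ∏)

open Equivalence using (from)

T-not⁻ : ∀ {x} → T (not x) → T x → ⊥
T-not⁻ {false} _ ()

T-not-∧⁺ : ∀ {x y} → (T x → T y → ⊥) → T (not (x ∧ y))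
T-not-∧⁺ {true}  {true}  ¬xy = ¬xy _ _
T-not-∧⁺ {true}  {false} _   = _
T-not-∧⁺ {false}         _   = _

[_] : Bool → ℕ
[ b ] = if b then 1 else 0

count : {A : Set} → (A → Bool) → List A → ℕ
count p xs = length (filterᵇ p xs)

module _ {A : Set} where

  count-mono : {p q : A → Bool} → (∀ x → T (p x) → T (q x)) →
               (xs : List A) → count p xs ≤ count q xs
  count-mono {p} {q} p⇒q xs =
    length-mono-≤ (filter⁺ (T? ∘ p) (T? ∘ q) (λ { refl → p⇒q _ }) (⊆-refl {x = xs}))

  count-++ : (p : A → Bool) (xs ys : List A) → count p (xs ++ ys) ≡ count p xs + count p ys
  count-++ p xs ys = trans (cong length (filter-++ (T? ∘ p) xs ys)) (length-++ (filterᵇ p xs))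

  count-concatMap : {B : Set} (p : A → Bool) (f : B → List A) (xs : List B) →
                    count p (concatMap f xs) ≡ sum (map (count p ∘ f) xs)
  count-concatMap p f []       = refl
  count-concatMap p f (x ∷ xs) =
    trans (count-++ p (f x) (concatMap f xs)) (cong (count p (f x) +_) (count-concatMap p f xs))

  count-map : {B : Set} (p : A → Bool) (f : B → A) (xs : List B) → count p (map f xs) ≡ count (p ∘ f) xs
  count-map p f []       = refl
  count-map p f (x ∷ xs) with p (f x)
  ... | true  = cong suc (count-map p f xs)
  ... | false = count-map p f xs

  count-∷ : (p : A → Bool) (x : A) (xs : List A) → count p (x ∷ xs) ≡ [ p x ] + count p xs
  count-∷ p x xs with p x
  ... | true  = refl
  ... | false = refl

  count-const-false : (xs : List A) → count (λ _ → false) xs ≡ 0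
  count-const-false []       = refl
  count-const-false (_ ∷ xs) = count-const-false xs

count-allVecs-suc : ∀ {m} (p : Vec Bool (suc m) → Bool) →
  count p (allVecs (suc m)) ≡ count (p ∘ (false ∷ᵥ_)) (allVecs m) + count (p ∘ (true ∷ᵥ_)) (allVecs m)
count-allVecs-suc {m} p = go (allVecs m)
  where
  open ≡-Reasoning

  p₀ p₁ : Vec Bool m → Bool
  p₀ = p ∘ (false ∷ᵥ_)
  p₁ = p ∘ (true ∷ᵥ_)

  go : (vs : List (Vec Bool m)) →
       count p (concatMap (λ v → (false ∷ᵥ v) ∷ (true ∷ᵥ v) ∷ []) vs) ≡ count p₀ vs + count p₁ vs
  go []       = refl
  go (v ∷ vs) = begin
    count p ((false ∷ᵥ v) ∷ (true ∷ᵥ v) ∷ concatMap _ vs)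
      ≡⟨ trans (count-∷ p _ _) (cong ([ p₀ v ] +_) (count-∷ p _ _)) ⟩
    [ p₀ v ] + ([ p₁ v ] + count p (concatMap _ vs))
      ≡⟨ cong (λ c → [ p₀ v ] + ([ p₁ v ] + c)) (go vs) ⟩
    [ p₀ v ] + ([ p₁ v ] + (count p₀ vs + count p₁ vs))
      ≡⟨ sym (+-assoc [ p₀ v ] [ p₁ v ] _) ⟩
    ([ p₀ v ] + [ p₁ v ]) + (count p₀ vs + count p₁ vs)
      ≡⟨ +-interchange [ p₀ v ] [ p₁ v ] (count p₀ vs) (count p₁ vs) ⟩
    ([ p₀ v ] + count p₀ vs) + ([ p₁ v ] + count p₁ vs)
      ≡⟨ sym (cong₂ _+_ (count-∷ p₀ v vs) (count-∷ p₁ v vs)) ⟩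
    count p₀ (v ∷ vs) + count p₁ (v ∷ vs) ∎

avoids : ∀ {m} → (Fin m → Bool) → Vec Bool m → Bool
avoids mask []ᵥ       = true
avoids mask (x ∷ᵥ v) = not (mask Fin.zero ∧ x) ∧ avoids (mask ∘ Fin.suc) v

avoids⁺ : ∀ {m} (mask : Fin m → Bool) (v : Vec Bool m) →
          (∀ j → T (mask j) → T (lookup v j) → ⊥) → T (avoids mask v)
avoids⁺ mask []ᵥ       _        = _
avoids⁺ mask (x ∷ᵥ v) disjoint =
  from T-∧ (T-not-∧⁺ (disjoint Fin.zero) , avoids⁺ (mask ∘ Fin.suc) v (disjoint ∘ Fin.suc))

-- the number of b : Bool with ¬ (x ∧ b)
weight : Bool → ℕ
weight true  = 1
weight false = 2

count-avoids : ∀ {m} (mask : Fin m → Bool) → count (avoids mask) (allVecs m) ≡ ∏ (weight ∘ mask)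
count-avoids {zero}  mask = refl
count-avoids {suc m} mask = begin
  count (avoids mask) (allVecs (suc m))
    ≡⟨ count-allVecs-suc (avoids mask) ⟩
  count (avoids mask ∘ (false ∷ᵥ_)) (allVecs m) + count (avoids mask ∘ (true ∷ᵥ_)) (allVecs m)
    ≡⟨ split (mask Fin.zero) ⟩
  weight (mask Fin.zero) * count rest (allVecs m)
    ≡⟨ cong (weight (mask Fin.zero) *_) (count-avoids (mask ∘ Fin.suc)) ⟩
  ∏ (weight ∘ mask) ∎
  where
  open ≡-Reasoning
  rest = avoids (mask ∘ Fin.suc)

  split : ∀ b → count (λ v → not (b ∧ false) ∧ rest v) (allVecs m) + count (λ v → not (b ∧ true) ∧ rest v) (allVecs m)
                  ≡ weight b * count rest (allVecs m)
  split true  = trans (cong (count rest (allVecs m) +_) (count-const-false (allVecs m)))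
                      (trans (+-identityʳ _) (sym (*-identityˡ _)))
  split false = cong (count rest (allVecs m) +_) (sym (+-identityʳ _))

sum-weights : ∀ m → sum (map (λ u → ∏ (weight ∘ lookup u)) (allVecs m)) ≡ 3 ^ m
sum-weights zero    = refl
sum-weights (suc m) = trans (go (allVecs m)) (cong (3 *_) (sum-weights m))
  where
  W : ∀ {k} → Vec Bool k → ℕ
  W u = ∏ (weight ∘ lookup u)

  open +-*-Solver
  regroup : ∀ w s → 2 * w + (1 * w + 3 * s) ≡ 3 * (w + s)
  regroup = solve 2 (λ w s → con 2 :* w :+ (con 1 :* w :+ con 3 :* s) := con 3 :* (w :+ s)) refl

  go : (us : List (Vec Bool m)) →
       sum (map W (concatMap (λ v → (false ∷ᵥ v) ∷ (true ∷ᵥ v) ∷ []) us)) ≡ 3 * sum (map W us)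
  go []       = refl
  go (u ∷ us) = trans (cong (λ s → 2 * W u + (1 * W u + s)) (go us)) (regroup (W u) (sum (map W us)))

module _ (n : ℕ) .{{_ : NonZero n}} where
  open ≡-Reasoning

  toℕ-mod : ∀ m → toℕ (m mod n) ≡ m % n
  toℕ-mod m = toℕ-fromℕ< _

  [m%n+k]%n≡[m+k]%n : ∀ m k → (m % n + k) % n ≡ (m + k) % n
  [m%n+k]%n≡[m+k]%n m k = begin
    (m % n + k) % n          ≡⟨ %-distribˡ-+ (m % n) k n ⟩
    (m % n % n + k % n) % n  ≡⟨ cong (λ x → (x + k % n) % n) (m%n%n≡m%n m n) ⟩
    (m % n + k % n) % n      ≡⟨ sym (%-distribˡ-+ m k n) ⟩
    (m + k) % n              ∎

  [m+k%n]%n≡[m+k]%n : ∀ m k → (m + k % n) % n ≡ (m + k) % n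
  [m+k%n]%n≡[m+k]%n m k = begin
    (m + k % n) % n  ≡⟨ cong (_% n) (+-comm m (k % n)) ⟩
    (k % n + m) % n  ≡⟨ [m%n+k]%n≡[m+k]%n k m ⟩
    (k + m) % n      ≡⟨ cong (_% n) (+-comm k m) ⟩
    (m + k) % n      ∎

  addₙ-comm : ∀ a b → addₙ n a b ≡ addₙ n b a
  addₙ-comm a b = cong (_mod n) (+-comm (toℕ a) (toℕ b))

  [b+c]%n≡0⇒[a+b]+c≡a : ∀ a b c → (toℕ b + toℕ c) % n ≡ 0 → addₙ n (addₙ n a b) c ≡ a
  [b+c]%n≡0⇒[a+b]+c≡a a b c b+c≡0 = toℕ-injective (begin
    toℕ (addₙ n (addₙ n a b) c)          ≡⟨ toℕ-mod _ ⟩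
    (toℕ (addₙ n a b) + toℕ c) % n      ≡⟨ cong (λ x → (x + toℕ c) % n) (toℕ-mod _) ⟩
    ((toℕ a + toℕ b) % n + toℕ c) % n    ≡⟨ [m%n+k]%n≡[m+k]%n _ _ ⟩
    (toℕ a + toℕ b + toℕ c) % n          ≡⟨ cong (_% n) (+-assoc (toℕ a) _ _) ⟩
    (toℕ a + (toℕ b + toℕ c)) % n        ≡⟨ sym ([m+k%n]%n≡[m+k]%n _ _) ⟩
    (toℕ a + (toℕ b + toℕ c) % n) % n    ≡⟨ cong (λ x → (toℕ a + x) % n) b+c≡0 ⟩
    (toℕ a + 0) % n                      ≡⟨ cong (_% n) (+-identityʳ _) ⟩
    toℕ a % n                            ≡⟨ m<n⇒m%n≡m (toℕ<n a) ⟩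
    toℕ a                                ∎)

  [c+negₙc]%n≡0 : ∀ c → (toℕ c + toℕ (negₙ n c)) % n ≡ 0
  [c+negₙc]%n≡0 c = begin
    (toℕ c + toℕ (negₙ n c)) % n    ≡⟨ cong (λ x → (toℕ c + x) % n) (toℕ-mod _) ⟩
    (toℕ c + (n ∸ toℕ c) % n) % n  ≡⟨ [m+k%n]%n≡[m+k]%n _ _ ⟩
    (toℕ c + (n ∸ toℕ c)) % n      ≡⟨ cong (_% n) (m+[n∸m]≡n (<⇒≤ (toℕ<n c))) ⟩
    n % n                          ≡⟨ n%n≡0 n ⟩
    0                              ∎

  [a-c]+c≡a : ∀ a c → addₙ n (addₙ n a (negₙ n c)) c ≡ a
  [a-c]+c≡a a c = [b+c]%n≡0⇒[a+b]+c≡a a (negₙ n c) c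
    (trans (cong (_% n) (+-comm (toℕ (negₙ n c)) (toℕ c))) ([c+negₙc]%n≡0 c))

  [a+c]-c≡a : ∀ a c → addₙ n (addₙ n a c) (negₙ n c) ≡ a
  [a+c]-c≡a a c = [b+c]%n≡0⇒[a+b]+c≡a a c (negₙ n c) ([c+negₙc]%n≡0 c)

  addₙ-cancelʳ-≡ : ∀ a b c → addₙ n a c ≡ addₙ n b c → a ≡ b
  addₙ-cancelʳ-≡ a b c a+c≡b+c = begin
    a                               ≡⟨ sym ([a+c]-c≡a a c) ⟩
    addₙ n (addₙ n a c) (negₙ n c)  ≡⟨ cong (λ x → addₙ n x (negₙ n c)) a+c≡b+c ⟩
    addₙ n (addₙ n b c) (negₙ n c)  ≡⟨ [a+c]-c≡a b c ⟩
    b                               ∎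

  ∈-allD : (x : D n) → x ∈ allD n
  ∈-allD (j , false) = ∈-++⁺ˡ (∈-map⁺ (_, false) (∈-allFin j))
  ∈-allD (j , true)  = ∈-++⁺ʳ (map (_, false) (allFin n)) (∈-map⁺ (_, true) (∈-allFin j))

  eqD-refl : (x : D n) → T (eqD n x x)
  eqD-refl (j , e) = fromWitness (refl , refl)

  mul-∈-sumset : (S : Subset n) (s t : D n) → T (_∈ₛ_ n s S) → T (_∈ₛ_ n t S) → T (inSumset n S (mul n s t))
  mul-∈-sumset S s t s∈S t∈S = any⁺ _ (lose (∈-allD s) (any⁺ _ (lose (∈-allD t)
    (from T-∧ (s∈S , from T-∧ (t∈S , eqD-refl (mul n s t)))))))

  mul-inv-∈-diffset : (S : Subset n) (s t : D n) → T (_∈ₛ_ n s S) → T (_∈ₛ_ n t S) → T (inDiffset n S (mul n s (inv n t)))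
  mul-inv-∈-diffset S s t s∈S t∈S = any⁺ _ (lose (∈-allD s) (any⁺ _ (lose (∈-allD t)
    (from T-∧ (s∈S , from T-∧ (t∈S , eqD-refl (mul n s (inv n t))))))))

module _ (n : ℕ) .{{_ : NonZero n}} (i : Fin n) where
  open ≡-Reasoning

  partner : Fin n → Fin n
  partner m = addₙ n i (negₙ n m)

  partner-involutive : ∀ m → partner (partner m) ≡ m
  partner-involutive m = addₙ-cancelʳ-≡ n (partner (partner m)) m (partner m) (begin
    addₙ n (partner (partner m)) (partner m)  ≡⟨ [a-c]+c≡a n i (partner m) ⟩
    i                                         ≡⟨ sym ([a-c]+c≡a n i m) ⟩
    addₙ n (partner m) m                      ≡⟨ addₙ-comm n (partner m) m ⟩
    addₙ n m (partner m)                      ∎)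

  partner-mul-reflection : ∀ m → mul n (partner m , false) (m , true) ≡ (i , true)
  partner-mul-reflection m = cong (_, true) ([a-c]+c≡a n i m)

  -- S = (u , v) contains none of the pairs {a^(i-m), aᵐ b}
  avoidsPartners : Subset n → Bool
  avoidsPartners (u , v) = avoids (lookup u ∘ partner) v

  ∉sumset⇒avoidsPartners : ∀ S → T (not (inSumset n S (i , true))) → T (avoidsPartners S)
  ∉sumset⇒avoidsPartners S@(u , v) k∉S+S = avoids⁺ (lookup u ∘ partner) v λ m u∋ v∋ →
    T-not⁻ k∉S+S (subst (T ∘ inSumset n S) (partner-mul-reflection m)
                        (mul-∈-sumset n S (partner m , false) (m , true) u∋ v∋))

  ∉diffset⇒avoidsPartners : ∀ S → T (not (inDiffset n S (i , true))) → T (avoidsPartners S)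
  ∉diffset⇒avoidsPartners S@(u , v) k∉S-S = avoids⁺ (lookup u ∘ partner) v λ m u∋ v∋ →
    T-not⁻ k∉S-S (subst (T ∘ inDiffset n S) (partner-mul-reflection m)
                        (mul-inv-∈-diffset n S (partner m , false) (m , true) u∋ v∋))

  count-avoidsPartners : count avoidsPartners (allSubsets n) ≡ 3 ^ n
  count-avoidsPartners = begin
    count avoidsPartners (allSubsets n)
      ≡⟨ count-concatMap avoidsPartners _ (allVecs n) ⟩
    sum (map (λ u → count avoidsPartners (map (u ,_) (allVecs n))) (allVecs n))
      ≡⟨ cong sum (map-cong count-row (allVecs n)) ⟩
    sum (map (λ u → ∏ (weight ∘ lookup u)) (allVecs n))
      ≡⟨ sum-weights n ⟩
    3 ^ n ∎
    where
    count-row : ∀ u → count avoidsPartners (map (u ,_) (allVecs n)) ≡ ∏ (weight ∘ lookup u)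
    count-row u = begin
      count avoidsPartners (map (u ,_) (allVecs n))  ≡⟨ count-map avoidsPartners (u ,_) (allVecs n) ⟩
      count (avoids (lookup u ∘ partner)) (allVecs n) ≡⟨ count-avoids (lookup u ∘ partner) ⟩
      ∏ (weight ∘ lookup u ∘ partner)                 ≡⟨ sym (sum-permute (weight ∘ lookup u) π) ⟩
      ∏ (weight ∘ lookup u)                           ∎
      where π = permutation partner partner partner-involutive partner-involutive

  count≤3^n : ∀ {p} → (∀ S → T (p S) → T (avoidsPartners S)) → count p (allSubsets n) ≤ 3 ^ n
  count≤3^n p⇒avoids = ≤-trans (count-mono p⇒avoids (allSubsets n)) (≤-reflexive count-avoidsPartners)

c≤3^n⇒c*4^n≤3^n*2^[2n] : ∀ n {c} → c ≤ 3 ^ n → c * 4 ^ n ≤ 3 ^ n * 2 ^ (2 * n)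
c≤3^n⇒c*4^n≤3^n*2^[2n] n {c} c≤3^n =
  subst (λ x → c * 4 ^ n ≤ 3 ^ n * x) (^-*-assoc 2 2 n) (*-monoˡ-≤ (4 ^ n) c≤3^n)

lemma7 : (n : ℕ) .{{_ : NonZero n}} (i : Fin n) →
    (countNotSum n (i , true) * 4 ^ n ≤ 3 ^ n * 2 ^ (2 * n))
      × (countNotDiff n (i , true) * 4 ^ n ≤ 3 ^ n * 2 ^ (2 * n))
lemma7 n i = c≤3^n⇒c*4^n≤3^n*2^[2n] n (count≤3^n n i (∉sumset⇒avoidsPartners n i))
           , c≤3^n⇒c*4^n≤3^n*2^[2n] n (count≤3^n n i (∉diffset⇒avoidsPartners n i))
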